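{- Let $\mathcal{V}$ be a finite set and $\mathcal{F}$ a finite family of subsets of $\mathcal{V}$, and let $BM$, $\mathrm{left}$, $\mathrm{right}$ and $\mathrm{Max}$ be as defined in the context. Let $X\in\mathcal{F}$. Then $\mathrm{Max}(X)\neq\emptyset$ if and only if there exists a row $t$ of $BM$ with $BM[t,\mathrm{left}(X)]=0$ and $BM[t,\mathrm{right}(X)]=1$ whose corresponding set $Y\in\mathcal{F}$ satisfies $|Y|\ge|X|$.
   Context: Two sets $A,B$ overlap if $A\cap B\neq\emptyset$, $A\setminus B\neq\emptyset$ and $B\setminus A\neq\emptyset$. $LF$ is the list of all sets of $\mathcal{F}$ sorted in decreasing order of size, ties broken in an arbitrary but fixed way. For $X\in\mathcal{F}$, $\mathrm{Max}(X)$ is the first set $Y$ in $LF$ order such that $|Y|\ge|X|$ and $Y$ overlaps $X$; if no such $Y$ exists one writes $\mathrm{Max}(X)=\emptyset$. $BM$ is the boolean matrix whose rows correspond to the sets of $\mathcal{F}$ in $LF$ order (top to bottom), whose columns correspond to the elements of $\mathcal{V}$ arranged so that the columns, each read as a $0/1$ word from top row to bottom row with $0<1$, are in increasing lexicographic order from left to right, and with entry $1$ iff the column's element belongs to the row's set. $\mathrm{left}(X)$ (resp. $\mathrm{right}(X)$) is the index of the column containing the leftmost (resp. rightmost) $1$ in the row of $X$. -}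

module Defs where

open import Data.Nat using (ℕ; _≤_; _<_; _≤?_)
open import Data.Bool using (Bool; true; false)
open import Data.Fin using (Fin) renaming (_≤_ to _≤ᶠ_; _<_ to _<ᶠ_)
open import Data.Fin.Subset using (Subset; _∈_; _∉_; ∣_∣)
open import Data.Fin.Subset.Properties using (_∈?_)
open import Data.Fin.Properties using (any?)
open import Data.Vec using (lookup)
open import Data.List using (allFin; find)
open import Data.Maybe using (Maybe)
open import Data.Product using (_×_; ∃; _,_)
open import Relation.Nullary using (Dec; ¬_)
open import Relation.Nullary.Decidable using (_×-dec_; ¬?)
open import Relation.Binary.PropositionalEquality using (_≡_)

-- Ground set 𝒱 = Fin n; the column order of BM is the index order on Fin n.
-- Family ℱ = F : Fin m → Subset n; row t of BM is the set F t, so the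
-- index order on Fin m is the LF order.

Overlaps : ∀ {n} → Subset n → Subset n → Set
Overlaps A B =
  (∃ λ c → c ∈ A × c ∈ B) × (∃ λ c → c ∈ A × c ∉ B) × (∃ λ c → c ∈ B × c ∉ A)

overlaps? : ∀ {n} (A B : Subset n) → Dec (Overlaps A B)
overlaps? A B =
  any? (λ c → (c ∈? A) ×-dec (c ∈? B)) ×-dec
  (any? (λ c → (c ∈? A) ×-dec ¬? (c ∈? B)) ×-dec
   any? (λ c → (c ∈? B) ×-dec ¬? (c ∈? A)))

module _ {n m : ℕ} (F : Fin m → Subset n) where

  BM : Fin m → Fin n → Bool
  BM t c = lookup (F t) c

  IsLF : Set
  IsLF = ∀ (s t : Fin m) → s ≤ᶠ t → ∣ F t ∣ ≤ ∣ F s ∣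

  ColLexLeq : Fin n → Fin n → Set
  ColLexLeq c d =
    (∀ t → BM t c ≡ BM t d) ⊎′
    (∃ λ t → BM t c ≡ false × BM t d ≡ true × (∀ s → s <ᶠ t → BM s c ≡ BM s d))
    where open import Data.Sum using () renaming (_⊎_ to _⊎′_)

  ColsSorted : Set
  ColsSorted = ∀ (c d : Fin n) → c ≤ᶠ d → ColLexLeq c d

  -- Max(X) for X = F x: the first row Y in LF order with |Y| ≥ |X| that
  -- overlaps X; nothing plays the role of ∅.
  Max : Fin m → Maybe (Fin m)
  Max x = find (λ t → (∣ F x ∣ ≤? ∣ F t ∣) ×-dec overlaps? (F t) (F x)) (allFin m)

  IsLeft : Fin m → Fin n → Set
  IsLeft x l = l ∈ F x × (∀ c → c ∈ F x → l ≤ᶠ c)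

  IsRight : Fin m → Fin n → Set
  IsRight x r = r ∈ F x × (∀ c → c ∈ F x → c ≤ᶠ r)

-- Among the columns of X, column left(X) is lexicographically least and
-- column right(X) greatest, so every column of X is sandwiched between them: on
-- any prefix of rows where left(X) and right(X) agree, all columns of X agree.
-- A set Y overlapping X contains some element of X and misses another, so the
-- columns of X disagree on the row of Y; hence the first row t where
-- BM[t, left(X)] = 0 and BM[t, right(X)] = 1 comes no later than Max(X), and
-- |Y| ≥ |X| is inherited by that earlier row. Conversely such a row t yields a
-- set Y = F t overlapping X: right(X) ∈ X ∩ Y, left(X) ∈ X ∖ Y, and Y ⊈ X
-- because Y ⊂ X would force |Y| < |X|.
module Submission where

open import Defs
open import Data.Nat using (ℕ; _≤_)
open import Data.Bool using (true; false)
open import Data.Fin using (Fin)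
open import Data.Fin.Subset using (Subset; ∣_∣)
open import Data.Maybe using (nothing)
open import Data.Product using (_×_; ∃)
open import Function.Bundles using (_⇔_)
open import Function.Definitions using (Injective)
open import Relation.Nullary using (¬_)
open import Relation.Binary.PropositionalEquality using (_≡_)

open import Data.Bool using (Bool)
open import Data.Empty using (⊥-elim)
open import Data.Fin using () renaming (_≤_ to _≤ᶠ_; _<_ to _<ᶠ_)
open import Data.Fin.Properties using (_≤?_; <-cmp; any?)
open import Data.Fin.Subset using (_∈_; _∉_; _⊂_)
open import Data.Fin.Subset.Properties using (_∈?_; p⊂q⇒∣p∣<∣q∣)
open import Data.List using ([]; _∷_; find; allFin)
open import Data.List.Membership.Propositional using (lose)
open import Data.List.Membership.Propositional.Properties using (∈-allFin)
open import Data.List.Relation.Unary.Any using (Any; here; there; satisfied)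
import Data.Nat.Properties as ℕ
open import Data.Product using (_,_; proj₁; proj₂)
open import Data.Sum using (_⊎_; inj₁; inj₂)
open import Data.Vec using (lookup)
open import Data.Vec.Properties using ([]=⇒lookup; lookup⇒[]=)
open import Function.Bundles using (mk⇔)
open import Relation.Binary.Definitions using (tri<; tri≈; tri>)
open import Relation.Binary.PropositionalEquality using (refl; sym; trans; module ≡-Reasoning)
open import Relation.Nullary using (yes; no; contradiction)
open import Relation.Nullary.Decidable using (_×-dec_; ¬?; decidable-stable)
open import Relation.Unary using (Pred; Decidable)

module _ {a p} {A : Set a} {P : Pred A p} (P? : Decidable P) where

  find≢nothing⇒Any : ∀ xs → ¬ (find P? xs ≡ nothing) → Any P xs
  find≢nothing⇒Any []       find≢nothing = contradiction refl find≢nothing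
  find≢nothing⇒Any (x ∷ xs) find≢nothing with P? x
  ... | yes px = here px
  ... | no  _  = there (find≢nothing⇒Any xs find≢nothing)

  Any⇒find≢nothing : ∀ {xs} → Any P xs → ¬ (find P? xs ≡ nothing)
  Any⇒find≢nothing {x ∷ _} (here px) with P? x
  ... | yes _   = λ ()
  ... | no  ¬px = contradiction px ¬px
  Any⇒find≢nothing {x ∷ _} (there pxs) with P? x
  ... | yes _ = λ ()
  ... | no  _ = Any⇒find≢nothing pxs

false≢true : ¬ (false ≡ true)
false≢true ()

lookup≡false⇒∉ : ∀ {n} {p : Subset n} {c : Fin n} → lookup p c ≡ false → c ∉ p
lookup≡false⇒∉ pc≡false c∈p = false≢true (trans (sym pc≡false) ([]=⇒lookup c∈p))

∣p∣≤∣q∣∧p⊈q⇒q⊈p : ∀ {n} {p q : Subset n} → ∣ p ∣ ≤ ∣ q ∣ →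
                  (∃ λ c → c ∈ p × c ∉ q) → ∃ λ d → d ∈ q × d ∉ p
∣p∣≤∣q∣∧p⊈q⇒q⊈p {p = p} {q} ∣p∣≤∣q∣ (c , c∈p , c∉q)
  with any? (λ d → (d ∈? q) ×-dec ¬? (d ∈? p))
... | yes q⊈p = q⊈p
... | no  q⊆p = contradiction ∣p∣≤∣q∣ (ℕ.<⇒≱ (p⊂q⇒∣p∣<∣q∣ q⊂p))
  where
  q⊂p : q ⊂ p
  q⊂p = (λ {d} d∈q → decidable-stable (d ∈? p) (λ d∉p → q⊆p (d , d∈q , d∉p)))
      , c , c∈p , c∉q

module _ {m : ℕ} where

  -- ColLexLeq F c d unfolds to (λ t → BM F t c) ≤ₗₑₓ (λ t → BM F t d).
  _≤ₗₑₓ_ : (Fin m → Bool) → (Fin m → Bool) → Set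
  u ≤ₗₑₓ v = (∀ t → u t ≡ v t)
           ⊎ (∃ λ t → u t ≡ false × v t ≡ true × (∀ s → s <ᶠ t → u s ≡ v s))

  AgreeUpTo : Fin m → (Fin m → Bool) → (Fin m → Bool) → Set
  AgreeUpTo y u v = ∀ s → s ≤ᶠ y → u s ≡ v s

  ≤ₗₑₓ-sandwich : ∀ {u v w} y → u ≤ₗₑₓ v → v ≤ₗₑₓ w →
                  AgreeUpTo y u w → AgreeUpTo y u v
  ≤ₗₑₓ-sandwich y (inj₁ u≡v) _ _ s _ = u≡v s
  ≤ₗₑₓ-sandwich {u} {v} {w} y (inj₂ (t₁ , u₀ , v₁ , u≡v<t₁)) v≤w u≡w s s≤y with t₁ ≤? y
  ... | no  t₁≰y = u≡v<t₁ s (ℕ.≤-<-trans s≤y (ℕ.≰⇒> t₁≰y))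
  ... | yes t₁≤y = ⊥-elim (no-second-difference v≤w)
    where
    w₀ : w t₁ ≡ false
    w₀ = trans (sym (u≡w t₁ t₁≤y)) u₀

    -- v already exceeds u at row t₁, where u and w still agree.
    no-second-difference : ¬ (v ≤ₗₑₓ w)
    no-second-difference (inj₁ v≡w) = false≢true (trans (sym w₀) (trans (sym (v≡w t₁)) v₁))
    no-second-difference (inj₂ (t₂ , v₀ , w₁ , v≡w<t₂)) with <-cmp t₂ t₁
    ... | tri< t₂<t₁ _ _ = false≢true (begin
      false ≡⟨ sym v₀ ⟩
      v t₂  ≡⟨ sym (u≡v<t₁ t₂ t₂<t₁) ⟩
      u t₂  ≡⟨ u≡w t₂ (ℕ.<⇒≤ (ℕ.<-≤-trans t₂<t₁ t₁≤y)) ⟩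
      w t₂  ≡⟨ w₁ ⟩
      true  ∎)
      where open ≡-Reasoning
    ... | tri≈ _ refl _  = false≢true (trans (sym v₀) v₁)
    ... | tri> _ _ t₁<t₂ = false≢true (trans (sym w₀) (trans (sym (v≡w<t₂ t₁ t₁<t₂)) v₁))

  ≤ₗₑₓ-differs-within : ∀ {u v} y → u ≤ₗₑₓ v → ¬ AgreeUpTo y u v →
                        ∃ λ t → t ≤ᶠ y × u t ≡ false × v t ≡ true
  ≤ₗₑₓ-differs-within y (inj₁ u≡v) u≢v = contradiction (λ s _ → u≡v s) u≢v
  ≤ₗₑₓ-differs-within y (inj₂ (t , u₀ , v₁ , u≡v<t)) u≢v with t ≤? y
  ... | yes t≤y = t , t≤y , u₀ , v₁
  ... | no  t≰y = contradiction (λ s s≤y → u≡v<t s (ℕ.≤-<-trans s≤y (ℕ.≰⇒> t≰y))) u≢v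

module _ {n m : ℕ} (F : Fin m → Subset n) (sorted : ColsSorted F)
         {x : Fin m} {l r : Fin n} (isLeft : IsLeft F x l) (isRight : IsRight F x r) where

  column : Fin n → Fin m → Bool
  column c t = BM F t c

  overlap⇒extremeColumns-differ : ∀ y → Overlaps (F y) (F x) →
                                  ¬ AgreeUpTo y (column l) (column r)
  overlap⇒extremeColumns-differ y ((c , c∈Y , c∈X) , _ , (e , e∈X , e∉Y)) l≡r =
    e∉Y (lookup⇒[]= e (F y) (begin
      column e y ≡⟨ sym (agreesWithLeft e∈X) ⟩
      column l y ≡⟨ agreesWithLeft c∈X ⟩
      column c y ≡⟨ []=⇒lookup c∈Y ⟩
      true       ∎))
    where
    open ≡-Reasoning

    agreesWithLeft : ∀ {d} → d ∈ F x → column l y ≡ column d y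
    agreesWithLeft {d} d∈X =
      ≤ₗₑₓ-sandwich y (sorted l d (proj₂ isLeft d d∈X)) (sorted d r (proj₂ isRight d d∈X))
                    l≡r y ℕ.≤-refl

lemma5 : ∀ (n m : ℕ) (F : Fin m → Subset n)
           → Injective _≡_ _≡_ F
           → IsLF F
           → ColsSorted F
           → ∀ (x : Fin m) (l r : Fin n)
           → IsLeft F x l
           → IsRight F x r
           → (¬ (Max F x ≡ nothing))
             ⇔ (∃ λ t → BM F t l ≡ false × BM F t r ≡ true × ∣ F x ∣ ≤ ∣ F t ∣)
lemma5 n m F _ isLF sorted x l r isLeft isRight = mk⇔ maxExists⇒row row⇒maxExists
  where
  candidate? : Decidable (λ t → ∣ F x ∣ ≤ ∣ F t ∣ × Overlaps (F t) (F x))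
  candidate? t = (∣ F x ∣ ℕ.≤? ∣ F t ∣) ×-dec overlaps? (F t) (F x)

  maxExists⇒row : ¬ (Max F x ≡ nothing) →
                  ∃ λ t → BM F t l ≡ false × BM F t r ≡ true × ∣ F x ∣ ≤ ∣ F t ∣
  maxExists⇒row Max≢nothing
    with satisfied (find≢nothing⇒Any candidate? (allFin m) Max≢nothing)
  ... | y , ∣X∣≤∣Y∣ , Y-overlaps-X
    with ≤ₗₑₓ-differs-within y (sorted l r (proj₂ isLeft r (proj₁ isRight)))
           (overlap⇒extremeColumns-differ F sorted isLeft isRight y Y-overlaps-X)
  ... | t , t≤y , l₀ , r₁ = t , l₀ , r₁ , ℕ.≤-trans ∣X∣≤∣Y∣ (isLF t y t≤y)

  row⇒maxExists : (∃ λ t → BM F t l ≡ false × BM F t r ≡ true × ∣ F x ∣ ≤ ∣ F t ∣) →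
                  ¬ (Max F x ≡ nothing)
  row⇒maxExists (t , l₀ , r₁ , ∣X∣≤∣T∣) =
    Any⇒find≢nothing candidate? (lose (∈-allFin t) (∣X∣≤∣T∣ , T-overlaps-X))
    where
    l∉T : l ∉ F t
    l∉T = lookup≡false⇒∉ l₀

    T-overlaps-X : Overlaps (F t) (F x)
    T-overlaps-X = (r , lookup⇒[]= r (F t) r₁ , proj₁ isRight)
                 , ∣p∣≤∣q∣∧p⊈q⇒q⊈p ∣X∣≤∣T∣ (l , proj₁ isLeft , l∉T)
                 , (l , proj₁ isLeft , l∉T)
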